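{- The polymodal provability logic $\mathsf{GLP}$ is sound for poly-provability $\mathsf{GLP}$-models: if $\mathsf{GLP}\vdash A$ and $\mathcal P$ is a poly-provability $\mathsf{GLP}$-model, then $\mathcal P,w\Vdash A$ for every world $w$ of $\mathcal P$.
   Context: Language $\mathcal L_\omega$: formulas built from atomic propositions and $\bot$ using $\to$ and unary modal operators $[n]$ for each $n\in\mathbb N$. Purely modal: Boolean combination of formulas $[n]B$. $\mathsf{GLP}$ has modus ponens as only rule and axioms: classical tautologies; $[n](A\to B)\to([n]A\to[n]B)$; $[n]A\to[n][n]A$; $[n]([n]A\to A)\to[n]A$; $[n]A\to[n+1]A$; $\neg[n]A\to[n+1]\neg[n]A$; and $[0]X$ for $X$ any of these axioms. A theory is a pair of a set of axioms and a set of inference rules (finitely many premises, one conclusion); $\mathsf T\vdash A$ means derivability; $\mathsf T\subseteq\mathsf T'$ means every theorem of $\mathsf T$ is a theorem of $\mathsf T'$. A poly-provability pre-model is $\mathcal P=(W,\{\sqsubset_n\}_{n\in\mathbb N},\{L^n_w\}_{n\in\mathbb N,w},V)$ with $W$ nonempty, each $\sqsubset_n$ a binary relation on $W$, $V\subseteq W\times\mathrm{atoms}$, and a theory $L^n_w$ for each $n$ and each $w\in W^{\sqsubset_0}=\{u:\exists v\,(v\sqsubset_0u)\}$. Satisfaction: atoms via $V$, $\bot$ never holds, $\to$ classical, $\mathcal P,w\Vdash[n]B$ iff $L^n_u\vdash B$ for all $u$ with $w\sqsubset_n u$. $\mathcal P,w\Vdash^+_0A$ iff $\mathcal P,u\Vdash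 A$ for every $u$ reachable from $w$ by a finite (possibly empty) chain of $\sqsubset_0$-steps. $\mathcal P$ is a poly-provability model if for all $n$ and $w\in W^{\sqsubset_0}$: $L^n_w$ is classical (all classical tautologies derivable, modus ponens a rule), and modal completeness holds: for purely modal $A$, $\mathcal P,w\Vdash^+_0A$ implies $L^0_w\vdash A$. It is a poly-provability $\mathsf{GLP}$-model if moreover: each $L^n_w$ has the rule "from $A$ infer $[n]A$" and the rule "from $[n]A\to A$ infer $A$"; ascending: $\sqsubset_{n+1}\subseteq\sqsubset_n$ and $L^n_w\subseteq L^{n+1}_w$; $\Pi$-completeness: if $u\sqsubset_{n+1}w$ and $\mathcal P,u\Vdash\neg[n]A$ then $L^{n+1}_w\vdash\neg[n]A$. -}

module Defs where

open import Level using (0ℓ)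
open import Data.Nat using (ℕ; suc)
open import Data.Bool using (Bool; true; false; _∨_; not)
open import Data.List using (List; []; _∷_)
open import Data.List.Membership.Propositional using (_∈_)
open import Data.Product using (Σ; ∃; _×_; _,_)
open import Data.Empty using (⊥)
open import Relation.Binary.PropositionalEquality using (_≡_)
open import Relation.Binary.Construct.Closure.ReflexiveTransitive using (Star)

infixr 6 _⇒_

data Fm : Set where
  atom : ℕ → Fm
  ⊥'   : Fm
  _⇒_  : Fm → Fm → Fm
  [_]_ : ℕ → Fm → Fm

¬' : Fm → Fm
¬' A = A ⇒ ⊥'

evalB : (ℕ → Bool) → (ℕ → Fm → Bool) → Fm → Bool
evalB va vb (atom p) = va p
evalB va vb ⊥' = false
evalB va vb (A ⇒ B) = not (evalB va vb A) ∨ evalB va vb B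
evalB va vb ([ n ] B) = vb n B

Tautology : Fm → Set
Tautology A = ∀ (va : ℕ → Bool) (vb : ℕ → Fm → Bool) → evalB va vb A ≡ true

data PurelyModal : Fm → Set where
  pm-box : ∀ n B → PurelyModal ([ n ] B)
  pm-⊥   : PurelyModal ⊥'
  pm-⇒   : ∀ {A B} → PurelyModal A → PurelyModal B → PurelyModal (A ⇒ B)

data GLPBaseAx : Fm → Set where
  taut  : ∀ {A} → Tautology A → GLPBaseAx A
  kax   : ∀ n A B → GLPBaseAx ([ n ] (A ⇒ B) ⇒ ([ n ] A ⇒ [ n ] B))
  four  : ∀ n A → GLPBaseAx ([ n ] A ⇒ [ n ] [ n ] A)
  löb   : ∀ n A → GLPBaseAx ([ n ] ([ n ] A ⇒ A) ⇒ [ n ] A)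
  mono  : ∀ n A → GLPBaseAx ([ n ] A ⇒ [ suc n ] A)
  neg   : ∀ n A → GLPBaseAx (¬' ([ n ] A) ⇒ [ suc n ] ¬' ([ n ] A))

data GLPAx : Fm → Set where
  base  : ∀ {A} → GLPBaseAx A → GLPAx A
  box0  : ∀ {X} → GLPBaseAx X → GLPAx ([ 0 ] X)

data GLP⊢ : Fm → Set where
  ax : ∀ {A} → GLPAx A → GLP⊢ A
  mp : ∀ {A B} → GLP⊢ A → GLP⊢ (A ⇒ B) → GLP⊢ B

record Theory : Set₁ where
  field
    Ax   : Fm → Set
    Rule : List Fm → Fm → Set
open Theory public

data _⊢_ (T : Theory) : Fm → Set where
  byAx   : ∀ {A} → Ax T A → T ⊢ A
  byRule : ∀ {Γ A} → Rule T Γ A → (∀ {B} → B ∈ Γ → T ⊢ B) → T ⊢ A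

_⊆T_ : Theory → Theory → Set
T ⊆T T' = ∀ {A} → T ⊢ A → T' ⊢ A

-- Poly-provability pre-model.  L n w is given for every world; only the
-- values at worlds in W^{⊏₀} are constrained.
record PreModel : Set₁ where
  field
    W : Set
    R : ℕ → W → W → Set
    L : ℕ → W → Theory
    V : W → ℕ → Set
open PreModel public

InW0 : (P : PreModel) → W P → Set
InW0 P w = ∃ λ v → R P 0 v w

_,_⊩_ : (P : PreModel) → W P → Fm → Set
P , w ⊩ atom p = V P w p
P , w ⊩ ⊥' = ⊥
P , w ⊩ (A ⇒ B) = P , w ⊩ A → P , w ⊩ B
P , w ⊩ ([ n ] B) = ∀ u → R P n w u → L P n u ⊢ B

_,_⊩⁺₀_ : (P : PreModel) → W P → Fm → Set
P , w ⊩⁺₀ A = ∀ u → Star (R P 0) w u → P , u ⊩ A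

Classical : Theory → Set
Classical T = (∀ A → Tautology A → T ⊢ A)
            × (∀ A B → Rule T (A ∷ (A ⇒ B) ∷ []) B)

record IsModel (P : PreModel) : Set where
  field
    classical : ∀ n w → InW0 P w → Classical (L P n w)
    modalComplete : ∀ w → InW0 P w → ∀ A → PurelyModal A →
                    P , w ⊩⁺₀ A → L P 0 w ⊢ A

record IsGLPModel (P : PreModel) : Set where
  field
    isModel : IsModel P
    necRule : ∀ n w → InW0 P w → ∀ A → Rule (L P n w) (A ∷ []) ([ n ] A)
    löbRule : ∀ n w → InW0 P w → ∀ A → Rule (L P n w) (([ n ] A ⇒ A) ∷ []) A
    ascR    : ∀ n u v → R P (suc n) u v → R P n u v
    ascL    : ∀ n w → InW0 P w → L P n w ⊆T L P (suc n) w
    Πcomplete : ∀ n u w A → R P (suc n) u w → P , u ⊩ ¬' ([ n ] A) →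
                L P (suc n) w ⊢ ¬' ([ n ] A)

-- Under excluded middle the
-- forcing relation at a world is a Boolean valuation of atoms and boxed
-- formulas, so tautologies hold everywhere.  Each modal axiom is matched by
-- a condition on GLP-models: K by classicality of Lⁿ, 4 by necessitation,
-- Löb by the Löb rule, [n]A → [n+1]A by ascendency, and ¬[n]A → [n+1]¬[n]A
-- by Π-completeness.  Finally [0]X holds because X is valid: every base
-- axiom X is a tautology or purely modal, so L⁰ proves it by classicality or
-- by modal completeness respectively.
module Submission where

open import Defs
open import Level using (0ℓ)
open import Axiom.ExcludedMiddle using (ExcludedMiddle)
open import Data.Nat using (ℕ; zero; suc)
open import Data.Bool using (Bool)
open import Data.List using ([]; _∷_)
open import Data.List.Relation.Unary.Any using (here; there)
open import Data.Product using (_,_; proj₁)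
open import Data.Sum using (_⊎_; inj₁; inj₂)
open import Relation.Nullary.Decidable using (does; proof)
open import Relation.Nullary.Reflects using (Reflects; ofⁿ; invert; _→-reflects_)
open import Relation.Binary.PropositionalEquality using (refl; subst)

modusPonens : ∀ {T A B} → Classical T → T ⊢ A → T ⊢ (A ⇒ B) → T ⊢ B
modusPonens {A = A} {B} (_ , mpRule) ⊢A ⊢A⇒B = byRule (mpRule A B) λ
  { (here refl) → ⊢A
  ; (there (here refl)) → ⊢A⇒B
  }

applyUnaryRule : ∀ {T A B} → Rule T (A ∷ []) B → T ⊢ A → T ⊢ B
applyUnaryRule rule ⊢A = byRule rule λ { (here refl) → ⊢A }

tautology⊎purelyModal : ∀ {X} → GLPBaseAx X → Tautology X ⊎ PurelyModal X
tautology⊎purelyModal (taut t)    = inj₁ t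
tautology⊎purelyModal (kax n A B) = inj₂ (pm-⇒ (pm-box _ _) (pm-⇒ (pm-box _ _) (pm-box _ _)))
tautology⊎purelyModal (four n A)  = inj₂ (pm-⇒ (pm-box _ _) (pm-box _ _))
tautology⊎purelyModal (löb n A)   = inj₂ (pm-⇒ (pm-box _ _) (pm-box _ _))
tautology⊎purelyModal (mono n A)  = inj₂ (pm-⇒ (pm-box _ _) (pm-box _ _))
tautology⊎purelyModal (neg n A)   = inj₂ (pm-⇒ (pm-⇒ (pm-box _ _) pm-⊥) (pm-box _ _))

module _ (em : ExcludedMiddle 0ℓ) (P : PreModel) where

  atomValuation : W P → ℕ → Bool
  atomValuation w p = does (em {V P w p})

  boxValuation : W P → ℕ → Fm → Bool
  boxValuation w n B = does (em {P , w ⊩ ([ n ] B)})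

  ⊩-reflects-evalB : ∀ w A →
    Reflects (P , w ⊩ A) (evalB (atomValuation w) (boxValuation w) A)
  ⊩-reflects-evalB w (atom p)  = proof em
  ⊩-reflects-evalB w ⊥'        = ofⁿ λ ()
  ⊩-reflects-evalB w (A ⇒ B)   = ⊩-reflects-evalB w A →-reflects ⊩-reflects-evalB w B
  ⊩-reflects-evalB w ([ n ] B) = proof em

  tautology-holds : ∀ {A} → Tautology A → ∀ w → P , w ⊩ A
  tautology-holds {A} t w =
    invert (subst (Reflects _) (t (atomValuation w) (boxValuation w)) (⊩-reflects-evalB w A))

module _ (P : PreModel) (G : IsGLPModel P) where
  open IsGLPModel G
  open IsModel isModel

  R⇒R₀ : ∀ n {w u} → R P n w u → R P 0 w u
  R⇒R₀ zero    w⊏u = w⊏u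
  R⇒R₀ (suc n) w⊏u = R⇒R₀ n (ascR n _ _ w⊏u)

  R-target-InW0 : ∀ n {w u} → R P n w u → InW0 P u
  R-target-InW0 n {w} w⊏u = w , R⇒R₀ n w⊏u

  module _ (em : ExcludedMiddle 0ℓ) where

    baseAx-holds : ∀ {X} → GLPBaseAx X → ∀ w → P , w ⊩ X
    baseAx-holds (taut {X} t) = tautology-holds em P {X} t
    baseAx-holds (kax n A B) w ⊩□A⇒B ⊩□A u w⊏u =
      modusPonens (classical n u (R-target-InW0 n w⊏u)) (⊩□A u w⊏u) (⊩□A⇒B u w⊏u)
    baseAx-holds (four n A) w ⊩□A u w⊏u =
      applyUnaryRule (necRule n u (R-target-InW0 n w⊏u) A) (⊩□A u w⊏u)
    baseAx-holds (löb n A) w ⊩□[□A⇒A] u w⊏u =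
      applyUnaryRule (löbRule n u (R-target-InW0 n w⊏u) A) (⊩□[□A⇒A] u w⊏u)
    baseAx-holds (mono n A) w ⊩□A u w⊏u =
      ascL n u (R-target-InW0 (suc n) w⊏u) (⊩□A u (ascR n w u w⊏u))
    baseAx-holds (neg n A) w ⊩¬□A u w⊏u = Πcomplete n w u A w⊏u ⊩¬□A

    baseAx-provable-in-L₀ : ∀ {X} → GLPBaseAx X → ∀ u → InW0 P u → L P 0 u ⊢ X
    baseAx-provable-in-L₀ {X} a u u∈W₀ with tautology⊎purelyModal a
    ... | inj₁ t  = proj₁ (classical 0 u u∈W₀) X t
    ... | inj₂ pm = modalComplete u u∈W₀ X pm λ v _ → baseAx-holds a v

    axiom-holds : ∀ {X} → GLPAx X → ∀ w → P , w ⊩ X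
    axiom-holds (base a) = baseAx-holds a
    axiom-holds (box0 a) w u w⊏u = baseAx-provable-in-L₀ a u (w , w⊏u)

    GLP-sound : ∀ {A} → GLP⊢ A → ∀ w → P , w ⊩ A
    GLP-sound (ax a)   w = axiom-holds a w
    GLP-sound (mp d e) w = GLP-sound e w (GLP-sound d w)

theorem6p2 : ExcludedMiddle 0ℓ → ∀ {A} → GLP⊢ A →
    (P : PreModel) → IsGLPModel P → ∀ (w : W P) → P , w ⊩ A
theorem6p2 em d P G = GLP-sound P G em d
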